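{- Let $k=3$ and let $A_n$, $\bar A_n$ be the antiregular $3$-hypergraphs defined in the context. Then for every integer $n\geq 1$, $$I(A_{2n-1};x)=3(1+x)^n+(1+x)^{n-1}-2nx-3,\qquad I(\bar A_{2n};x)=3(1+x)^{n+1}+(1+x)^n-(1+x)(2nx+3),$$ and $$I(\bar A_{2n-1};x)=(1+x)^{n+1}+3(1+x)^n-(1+x)\big((2n-1)x+3\big),\qquad I(A_{2n};x)=(1+x)^{n+1}+3(1+x)^n-(2n+1)x-3.$$
   Context: Here $k=3$ and all hypergraphs are $3$-uniform (every hyperedge has exactly $3$ vertices). For a binary string $b=b_1\cdots b_n$, let $H(b)$ be the $3$-uniform hypergraph on $\{1,\dots,n\}$ in which a $3$-subset is a hyperedge iff its largest element $j$ satisfies $b_j=1$ (i.e., vertices are added in order, vertex $j$ as an isolated vertex if $b_j=0$ and as a dominating vertex, joined in a hyperedge with every $2$-subset of earlier vertices, if $b_j=1$). For $n\le 2$, $A_n=\bar A_n$ is the edgeless hypergraph on $n$ vertices. For $n\geq 3$, $A_n=H(b)$ where $b$ has length $n$, $b_1=b_2=0$, the bits $b_3,\dots,b_n$ alternate, and $b_n=1$; $\bar A_n$ is the same with $b_n=0$. A vertex set is independent if it contains no hyperedge, and $I(H;x)=\sum_{W\text{ independent}}x^{|W|}$. -}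

module Defs where

open import Data.Bool using (Bool; true; false; not)
open import Data.Nat using (ℕ; zero; suc; _≤?_; _∸_)
open import Data.Fin using (Fin; toℕ; _<_; _<?_)
open import Data.Fin.Subset using (Subset; _∈_; ∣_∣; inside; outside)
open import Data.Fin.Subset.Properties using (_∈?_)
open import Data.Fin.Properties using (all?)
open import Data.Vec using (Vec; []; _∷_; lookup; tabulate)
open import Data.List using (List; []; _∷_; _++_; map; sum)
open import Data.Product using (_×_)
open import Data.Integer using (ℤ; _^_) renaming (_+_ to _+ℤ_)
open import Data.Empty using (⊥)
open import Relation.Nullary using (Dec; yes; no; ¬_)
open import Relation.Nullary.Decidable using (_×-dec_; _→-dec_; ¬?)
open import Relation.Binary.PropositionalEquality using (_≡_)
open import Data.Bool.Properties using () renaming (_≟_ to _≟B_)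

-- A binary string b = b₁⋯bₙ, stored 0-based: vertex j+1 ↔ index j : Fin n.

Hyperedge : {n : ℕ} → Vec Bool n → Fin n → Fin n → Fin n → Set
Hyperedge b i j l = (i < j) × (j < l) × (lookup b l ≡ true)

Independent : {n : ℕ} → Vec Bool n → Subset n → Set
Independent b W = ∀ i j l → Hyperedge b i j l → i ∈ W → j ∈ W → l ∈ W → ⊥

independent? : {n : ℕ} (b : Vec Bool n) (W : Subset n) → Dec (Independent b W)
independent? b W =
  all? λ i → all? λ j → all? λ l →
    ((i <? j) ×-dec (j <? l) ×-dec (lookup b l ≟B true))
      →-dec (i ∈? W) →-dec (j ∈? W) →-dec (l ∈? W) →-dec no (λ ())

allSubsets : (n : ℕ) → List (Subset n)
allSubsets zero = [] ∷ []
allSubsets (suc n) = map (outside ∷_) (allSubsets n) ++ map (inside ∷_) (allSubsets n)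

indepPoly : {n : ℕ} → Vec Bool n → ℤ → ℤ
indepPoly {n} b x = Data.List.foldr _+ℤ_ (Data.Integer.+ 0) (map term (allSubsets n))
  where
  term : Subset _ → ℤ
  term W with independent? b W
  ... | yes _ = x ^ ∣ W ∣
  ... | no _  = Data.Integer.+ 0

isEven : ℕ → Bool
isEven zero = true
isEven (suc m) = not (isEven m)

-- Bits of A_n: b₁ = b₂ = 0, b₃,…,bₙ alternate, bₙ = 1  (b_j = 1 iff j ≥ 3 and n − j even).
-- For n ≤ 2 all bits are 0 (edgeless).
bitsA : (n : ℕ) → Vec Bool n
bitsA n = tabulate λ (j : Fin n) → bit (suc (toℕ j))
  where
  bit : ℕ → Bool
  bit v with 3 ≤? v
  ... | yes _ = isEven (n ∸ v)
  ... | no _  = false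

-- Bits of Ā_n: same but bₙ = 0  (b_j = 1 iff j ≥ 3 and n − j odd).
bitsĀ : (n : ℕ) → Vec Bool n
bitsĀ n = tabulate λ (j : Fin n) → bit (suc (toℕ j))
  where
  bit : ℕ → Bool
  bit v with 3 ≤? v
  ... | yes _ = not (isEven (n ∸ v))
  ... | no _  = false

I-A : ℕ → ℤ → ℤ
I-A n = indepPoly (bitsA n)

I-Ā : ℕ → ℤ → ℤ
I-Ā n = indepPoly (bitsĀ n)

-- Split the independent sets W of H(b) according to whether the first vertex u lies in W.
-- If it does not, W is independent in H(b) with u deleted; if it does, W ∖ {u} must avoid
-- every pair j < l with l dominating.  Splitting that family at its first vertex in turn
-- leads to the sets containing no dominating vertex, whose recursion closes up.  So the
-- triple of generating polynomials of these three families evolves by one of two fixed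
-- linear maps per bit; along an alternating string the maps alternate, and iterating their
-- composite gives the closed forms.

{-# OPTIONS --safe #-}
module Submission where

open import Defs
open import Data.Bool using (Bool; true; false; not; _xor_)
open import Data.Bool.Properties using (not-involutive; xor-identityʳ) renaming (_≟_ to _≟B_)
open import Data.Empty using (⊥; ⊥-elim)
open import Data.Fin using (Fin; zero; suc; toℕ; _<_; _<?_)
open import Data.Fin.Properties using (all?)
open import Data.Fin.Subset using (Subset; _∈_; ∣_∣; inside; outside)
open import Data.Fin.Subset.Properties using (_∈?_)
open import Data.Integer using (ℤ; +_; _+_; _-_; _*_; _^_)
open import Data.Integer.Properties using (+-identityˡ; +-identityʳ; +-assoc; *-zeroʳ; *-distribˡ-+)
open import Data.Integer.Tactic.RingSolver using (solve-∀)
open import Data.List using (List; []; _∷_; _++_; map; foldr)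
open import Data.List.Properties using (map-++; map-∘)
open import Data.Nat using (ℕ; zero; suc; _≥_; _∸_; z≤n; s≤s) renaming (_*_ to _*ℕ_; _+_ to _+ℕ_)
open import Data.Nat.Properties using () renaming (*-suc to *ℕ-suc)
open import Data.Product using (_×_; _,_; proj₁; proj₂; ∃-syntax)
open import Data.Vec using (Vec; []; _∷_; lookup; tabulate; here; there)
open import Function using (_∘_; _⇔_; mk⇔; Equivalence)
open import Relation.Nullary using (Dec; yes; no; ¬_)
open import Relation.Nullary.Decidable using (_→-dec_)
open import Relation.Unary using (Pred; Decidable)
open import Relation.Binary.PropositionalEquality
  using (_≡_; refl; sym; trans; cong; cong₂; module ≡-Reasoning)
open import Level using (0ℓ)

open ≡-Reasoning

subsetSum : ∀ {n} → (Subset n → ℤ) → ℤ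
subsetSum {zero}  f = f []
subsetSum {suc n} f = subsetSum (f ∘ (outside ∷_)) + subsetSum (f ∘ (inside ∷_))

foldr-+-++ : ∀ (xs ys : List ℤ) → foldr _+_ (+ 0) (xs ++ ys) ≡ foldr _+_ (+ 0) xs + foldr _+_ (+ 0) ys
foldr-+-++ []       ys = sym (+-identityˡ _)
foldr-+-++ (a ∷ xs) ys = trans (cong (λ s → a + s) (foldr-+-++ xs ys)) (sym (+-assoc a _ _))

foldr-+-allSubsets : ∀ n (f : Subset n → ℤ) → foldr _+_ (+ 0) (map f (allSubsets n)) ≡ subsetSum f
foldr-+-allSubsets zero    f = +-identityʳ (f [])
foldr-+-allSubsets (suc n) f = begin
  Σ (map f (map (outside ∷_) S ++ map (inside ∷_) S))
    ≡⟨ cong Σ (map-++ f (map (outside ∷_) S) _) ⟩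
  Σ (map f (map (outside ∷_) S) ++ map f (map (inside ∷_) S))
    ≡⟨ foldr-+-++ (map f (map (outside ∷_) S)) _ ⟩
  Σ (map f (map (outside ∷_) S)) + Σ (map f (map (inside ∷_) S))
    ≡⟨ cong₂ _+_ (cong Σ (sym (map-∘ S))) (cong Σ (sym (map-∘ S))) ⟩
  Σ (map (f ∘ (outside ∷_)) S) + Σ (map (f ∘ (inside ∷_)) S)
    ≡⟨ cong₂ _+_ (foldr-+-allSubsets n _) (foldr-+-allSubsets n _) ⟩
  subsetSum (f ∘ (outside ∷_)) + subsetSum (f ∘ (inside ∷_)) ∎
  where
  Σ : List ℤ → ℤ
  Σ = foldr _+_ (+ 0)
  S : List (Subset n)
  S = allSubsets n

subsetSum-cong : ∀ {n} {f g : Subset n → ℤ} → (∀ W → f W ≡ g W) → subsetSum f ≡ subsetSum g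
subsetSum-cong {zero}  f≗g = f≗g []
subsetSum-cong {suc n} f≗g =
  cong₂ _+_ (subsetSum-cong (f≗g ∘ (outside ∷_))) (subsetSum-cong (f≗g ∘ (inside ∷_)))

subsetSum-*ˡ : ∀ {n} c (f : Subset n → ℤ) → subsetSum (λ W → c * f W) ≡ c * subsetSum f
subsetSum-*ˡ {zero}  c f = refl
subsetSum-*ˡ {suc n} c f =
  trans (cong₂ _+_ (subsetSum-*ˡ c (f ∘ (outside ∷_))) (subsetSum-*ˡ c (f ∘ (inside ∷_))))
        (sym (*-distribˡ-+ c _ _))

subsetSum-zero : ∀ {n} → subsetSum {n} (λ _ → + 0) ≡ + 0
subsetSum-zero {zero}  = refl
subsetSum-zero {suc n} = cong₂ _+_ (subsetSum-zero {n}) (subsetSum-zero {n})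

module _ (x : ℤ) where

  weight : ∀ {n} {A : Set} → Dec A → Subset n → ℤ
  weight (yes _) W = x ^ ∣ W ∣
  weight (no _)  W = + 0

  familyPoly : ∀ {n} {P : Pred (Subset n) 0ℓ} → Decidable P → ℤ
  familyPoly P? = subsetSum (λ W → weight (P? W) W)

  weight-outside : ∀ {n} {A : Set} (d : Dec A) (W : Subset n) → weight d (outside ∷ W) ≡ weight d W
  weight-outside (yes _) W = refl
  weight-outside (no _)  W = refl

  weight-inside : ∀ {n} {A : Set} (d : Dec A) (W : Subset n) → weight d (inside ∷ W) ≡ x * weight d W
  weight-inside (yes _) W = refl
  weight-inside (no _)  W = sym (*-zeroʳ x)

  weight-⇔ : ∀ {n} {A B : Set} (d : Dec A) (e : Dec B) (W : Subset n) → A ⇔ B → weight d W ≡ weight e W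
  weight-⇔ (yes _) (yes _) W A⇔B = refl
  weight-⇔ (no _)  (no _)  W A⇔B = refl
  weight-⇔ (yes a) (no ¬b) W A⇔B = ⊥-elim (¬b (Equivalence.to A⇔B a))
  weight-⇔ (no ¬a) (yes b) W A⇔B = ⊥-elim (¬a (Equivalence.from A⇔B b))

  familyPoly-empty : ∀ {n} {P : Pred (Subset n) 0ℓ} (P? : Decidable P) → (∀ W → ¬ P W) → familyPoly P? ≡ + 0
  familyPoly-empty {n} P? ¬P = trans (subsetSum-cong weight≡0) (subsetSum-zero {n})
    where
    weight≡0 : ∀ W → weight (P? W) W ≡ + 0
    weight≡0 W with P? W
    ... | yes p = ⊥-elim (¬P W p)
    ... | no _  = refl

  familyPoly-split : ∀ {n} {P : Pred (Subset (suc n)) 0ℓ} {Q R : Pred (Subset n) 0ℓ}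
    (P? : Decidable P) (Q? : Decidable Q) (R? : Decidable R) →
    (∀ W → P (outside ∷ W) ⇔ Q W) → (∀ W → P (inside ∷ W) ⇔ R W) →
    familyPoly P? ≡ familyPoly Q? + x * familyPoly R?
  familyPoly-split P? Q? R? out⇔ in⇔ = cong₂ _+_
    (subsetSum-cong λ W → trans (weight-outside (P? (outside ∷ W)) W)
                                (weight-⇔ (P? (outside ∷ W)) (Q? W) W (out⇔ W)))
    (trans (subsetSum-cong λ W → trans (weight-inside (P? (inside ∷ W)) W)
                                       (cong (x *_) (weight-⇔ (P? (inside ∷ W)) (R? W) W (in⇔ W))))
           (subsetSum-*ˡ x (λ W → weight (R? W) W)))

-- For new vertices u < v placed before all of H(b), NoDominatedPair b W says that {v} ∪ W
-- is independent and NoDominator b W that {u, v} ∪ W is.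
NoDominatedPair : ∀ {n} → Vec Bool n → Subset n → Set
NoDominatedPair b W = ∀ j l → j < l → lookup b l ≡ true → j ∈ W → l ∈ W → ⊥

NoDominator : ∀ {n} → Vec Bool n → Subset n → Set
NoDominator b W = ∀ l → lookup b l ≡ true → l ∈ W → ⊥

noDominatedPair? : ∀ {n} (b : Vec Bool n) → Decidable (NoDominatedPair b)
noDominatedPair? b W = all? λ j → all? λ l →
  (j <? l) →-dec (lookup b l ≟B true) →-dec (j ∈? W) →-dec (l ∈? W) →-dec no (λ ())

noDominator? : ∀ {n} (b : Vec Bool n) → Decidable (NoDominator b)
noDominator? b W = all? λ l → (lookup b l ≟B true) →-dec (l ∈? W) →-dec no (λ ())

module _ {n : ℕ} {c : Bool} {b : Vec Bool n} {W : Subset n} where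

  independent-outside : Independent (c ∷ b) (outside ∷ W) ⇔ Independent b W
  independent-outside = mk⇔ to from
    where
    to : Independent (c ∷ b) (outside ∷ W) → Independent b W
    to ind i j l (i<j , j<l , bₗ) i∈W j∈W l∈W =
      ind (suc i) (suc j) (suc l) (s≤s i<j , s≤s j<l , bₗ) (there i∈W) (there j∈W) (there l∈W)
    from : Independent b W → Independent (c ∷ b) (outside ∷ W)
    from ind zero    j       l       _            ()  _ _
    from ind (suc i) zero    l       (() , _)     _   _ _
    from ind (suc i) (suc j) zero    (_ , () , _) _   _ _
    from ind (suc i) (suc j) (suc l) (s≤s i<j , s≤s j<l , bₗ) (there i∈W) (there j∈W) (there l∈W) =
      ind i j l (i<j , j<l , bₗ) i∈W j∈W l∈W

  independent-inside : Independent (c ∷ b) (inside ∷ W) ⇔ NoDominatedPair b W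
  independent-inside = mk⇔ to from
    where
    to : Independent (c ∷ b) (inside ∷ W) → NoDominatedPair b W
    to ind j l j<l bₗ j∈W l∈W =
      ind zero (suc j) (suc l) (s≤s z≤n , s≤s j<l , bₗ) here (there j∈W) (there l∈W)
    from : NoDominatedPair b W → Independent (c ∷ b) (inside ∷ W)
    from free i zero    l       (() , _)     _ _ _
    from free i (suc j) zero    (_ , () , _) _ _ _
    from free i (suc j) (suc l) (_ , s≤s j<l , bₗ) _ (there j∈W) (there l∈W) = free j l j<l bₗ j∈W l∈W

  noDominatedPair-outside : NoDominatedPair (c ∷ b) (outside ∷ W) ⇔ NoDominatedPair b W
  noDominatedPair-outside = mk⇔ to from
    where
    to : NoDominatedPair (c ∷ b) (outside ∷ W) → NoDominatedPair b W
    to free j l j<l bₗ j∈W l∈W = free (suc j) (suc l) (s≤s j<l) bₗ (there j∈W) (there l∈W)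
    from : NoDominatedPair b W → NoDominatedPair (c ∷ b) (outside ∷ W)
    from free zero    l       j<l       bₗ () _
    from free (suc j) zero    ()        bₗ _  _
    from free (suc j) (suc l) (s≤s j<l) bₗ (there j∈W) (there l∈W) = free j l j<l bₗ j∈W l∈W

  noDominatedPair-inside : NoDominatedPair (c ∷ b) (inside ∷ W) ⇔ NoDominator b W
  noDominatedPair-inside = mk⇔ to from
    where
    to : NoDominatedPair (c ∷ b) (inside ∷ W) → NoDominator b W
    to free l bₗ l∈W = free zero (suc l) (s≤s z≤n) bₗ here (there l∈W)
    from : NoDominator b W → NoDominatedPair (c ∷ b) (inside ∷ W)
    from free j zero    ()  _  _ _
    from free j (suc l) j<l bₗ _ (there l∈W) = free l bₗ l∈W

  noDominator-outside : NoDominator (c ∷ b) (outside ∷ W) ⇔ NoDominator b W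
  noDominator-outside = mk⇔ to from
    where
    to : NoDominator (c ∷ b) (outside ∷ W) → NoDominator b W
    to free l bₗ l∈W = free (suc l) bₗ (there l∈W)
    from : NoDominator b W → NoDominator (c ∷ b) (outside ∷ W)
    from free zero    bₗ ()
    from free (suc l) bₗ (there l∈W) = free l bₗ l∈W

module _ {n : ℕ} {b : Vec Bool n} {W : Subset n} where

  noDominator-inside-false : NoDominator (false ∷ b) (inside ∷ W) ⇔ NoDominator b W
  noDominator-inside-false = mk⇔ to from
    where
    to : NoDominator (false ∷ b) (inside ∷ W) → NoDominator b W
    to free l bₗ l∈W = free (suc l) bₗ (there l∈W)
    from : NoDominator b W → NoDominator (false ∷ b) (inside ∷ W)
    from free zero    () _
    from free (suc l) bₗ (there l∈W) = free l bₗ l∈W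

  noDominator-inside-true : ¬ NoDominator (true ∷ b) (inside ∷ W)
  noDominator-inside-true free = free zero refl here

module _ (x : ℤ) where

  prepend : Bool → ℤ × ℤ × ℤ → ℤ × ℤ × ℤ
  prepend true  (p₁ , p₂ , p₃) = p₁ , p₂ + x * p₁ , p₃ + x * p₂
  prepend false (p₁ , p₂ , p₃) = p₁ + x * p₁ , p₂ + x * p₁ , p₃ + x * p₂

  profile : ∀ {n} → Vec Bool n → ℤ × ℤ × ℤ
  profile []      = + 1 , + 1 , + 1
  profile (c ∷ b) = prepend c (profile b)

  familyPolys : ∀ {n} → Vec Bool n → ℤ × ℤ × ℤ
  familyPolys b =
    familyPoly x (noDominator? b) , familyPoly x (noDominatedPair? b) , familyPoly x (independent? b)

  independent-split : ∀ {n} c (b : Vec Bool n) →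
    familyPoly x (independent? (c ∷ b)) ≡ familyPoly x (independent? b) + x * familyPoly x (noDominatedPair? b)
  independent-split c b = familyPoly-split x (independent? (c ∷ b)) (independent? b) (noDominatedPair? b)
    (λ _ → independent-outside) (λ _ → independent-inside)

  noDominatedPair-split : ∀ {n} c (b : Vec Bool n) →
    familyPoly x (noDominatedPair? (c ∷ b)) ≡ familyPoly x (noDominatedPair? b) + x * familyPoly x (noDominator? b)
  noDominatedPair-split c b = familyPoly-split x (noDominatedPair? (c ∷ b)) (noDominatedPair? b) (noDominator? b)
    (λ _ → noDominatedPair-outside) (λ _ → noDominatedPair-inside)

  noDominator-split-false : ∀ {n} (b : Vec Bool n) →
    familyPoly x (noDominator? (false ∷ b)) ≡ familyPoly x (noDominator? b) + x * familyPoly x (noDominator? b)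
  noDominator-split-false b = familyPoly-split x (noDominator? (false ∷ b)) (noDominator? b) (noDominator? b)
    (λ _ → noDominator-outside) (λ _ → noDominator-inside-false)

  noDominator-split-true : ∀ {n} (b : Vec Bool n) →
    familyPoly x (noDominator? (true ∷ b)) ≡ familyPoly x (noDominator? b)
  noDominator-split-true b = begin
    familyPoly x (noDominator? (true ∷ b))
      ≡⟨ familyPoly-split x (noDominator? (true ∷ b)) (noDominator? b) never
           (λ _ → noDominator-outside) (λ _ → mk⇔ noDominator-inside-true (λ ())) ⟩
    p + x * familyPoly x never    ≡⟨ cong (λ s → p + x * s) (familyPoly-empty x never (λ _ ())) ⟩
    p + x * + 0                   ≡⟨ cong (λ s → p + s) (*-zeroʳ x) ⟩
    p + + 0                       ≡⟨ +-identityʳ p ⟩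
    p                             ∎
    where
    p : ℤ
    p = familyPoly x (noDominator? b)
    never : Decidable {A = Subset _} (λ _ → ⊥)
    never _ = no (λ ())

  prepend-familyPolys : ∀ {n} c (b : Vec Bool n) → prepend c (familyPolys b) ≡ familyPolys (c ∷ b)
  prepend-familyPolys true b = cong₂ _,_ (sym (noDominator-split-true b))
    (cong₂ _,_ (sym (noDominatedPair-split true b)) (sym (independent-split true b)))
  prepend-familyPolys false b = cong₂ _,_ (sym (noDominator-split-false b))
    (cong₂ _,_ (sym (noDominatedPair-split false b)) (sym (independent-split false b)))

  profile≡familyPolys : ∀ {n} (b : Vec Bool n) → profile b ≡ familyPolys b
  profile≡familyPolys []      = refl
  profile≡familyPolys (c ∷ b) = trans (cong (prepend c) (profile≡familyPolys b)) (prepend-familyPolys c b)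

third : ℤ × ℤ × ℤ → ℤ
third = proj₂ ∘ proj₂

-- Exposes the summand local to indepPoly, so that it can be analysed with `with`.
indepPoly-summand : ∀ {n} (b : Vec Bool n) (x : ℤ) →
  ∃[ t ] indepPoly b x ≡ foldr _+_ (+ 0) (map t (allSubsets n))
indepPoly-summand b x = _ , refl

indepPoly-summand≡weight : ∀ {n} (b : Vec Bool n) x W →
  proj₁ (indepPoly-summand b x) W ≡ weight x (independent? b W) W
indepPoly-summand≡weight b x W with independent? b W
... | yes _ = refl
... | no _  = refl

indepPoly≡familyPoly : ∀ {n} (b : Vec Bool n) x → indepPoly b x ≡ familyPoly x (independent? b)
indepPoly≡familyPoly {n} b x =
  trans (proj₂ (indepPoly-summand b x))
        (trans (foldr-+-allSubsets n _) (subsetSum-cong (indepPoly-summand≡weight b x)))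

indepPoly≡profile : ∀ {n} (b : Vec Bool n) x → indepPoly b x ≡ third (profile x b)
indepPoly≡profile b x = trans (indepPoly≡familyPoly b x) (cong third (sym (profile≡familyPolys x b)))

-- The alternating string of length M whose last bit is c.
alternating : Bool → (M : ℕ) → Vec Bool M
alternating c zero    = []
alternating c (suc M) = (not c xor isEven M) ∷ alternating c M

tabulate-alternating : ∀ c M → tabulate (λ (i : Fin M) → not c xor isEven (M ∸ suc (toℕ i))) ≡ alternating c M
tabulate-alternating c zero    = refl
tabulate-alternating c (suc M) = cong ((not c xor isEven M) ∷_) (tabulate-alternating c M)

bitsA-alternating : ∀ M → bitsA (suc (suc M)) ≡ false ∷ false ∷ alternating true M
bitsA-alternating M = cong (λ v → false ∷ false ∷ v) (tabulate-alternating true M)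

bitsĀ-alternating : ∀ M → bitsĀ (suc (suc M)) ≡ false ∷ false ∷ alternating false M
bitsĀ-alternating M = cong (λ v → false ∷ false ∷ v) (tabulate-alternating false M)

isEven-double : ∀ k → isEven (2 *ℕ k) ≡ true
isEven-double zero    = refl
isEven-double (suc k) = begin
  isEven (2 *ℕ suc k)             ≡⟨ cong isEven (*ℕ-suc 2 k) ⟩
  not (not (isEven (2 *ℕ k)))     ≡⟨ not-involutive _ ⟩
  isEven (2 *ℕ k)                 ≡⟨ isEven-double k ⟩
  true                            ∎

alternating-suc-double : ∀ c k → alternating c (suc (2 *ℕ k)) ≡ c ∷ alternating c (2 *ℕ k)
alternating-suc-double c k rewrite isEven-double k with c
... | true  = refl
... | false = refl

double-suc-suc∸1 : ∀ k → 2 *ℕ suc (suc k) ∸ 1 ≡ suc (suc (suc (2 *ℕ k)))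
double-suc-suc∸1 k = cong (_∸ 1) (trans (*ℕ-suc 2 (suc k)) (cong (λ (N : ℕ) → suc (suc N)) (*ℕ-suc 2 k)))

alternating-suc-suc-double : ∀ c k → alternating c (suc (suc (2 *ℕ k))) ≡ not c ∷ c ∷ alternating c (2 *ℕ k)
alternating-suc-suc-double c k = cong₂ _∷_ head (alternating-suc-double c k)
  where
  head : not c xor not (isEven (2 *ℕ k)) ≡ not c
  head = trans (cong (λ e → not c xor not e) (isEven-double k)) (xor-identityʳ (not c))

module _ (x : ℤ) where

  -- The profile after k pairs of bits, with Y = (1 + x)^k and K = k.
  alternatingTrueForm : ℤ → ℤ → ℤ × ℤ × ℤ
  alternatingTrueForm Y K = Y , + 2 * Y - + 1 , (x + + 4) * Y - (+ 2 * K + + 1) * x - + 3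

  alternatingFalseForm : ℤ → ℤ → ℤ × ℤ × ℤ
  alternatingFalseForm Y K =
    Y , (+ 2 + x) * Y - + 1 - x , (+ 4 + + 3 * x) * Y - + 2 * K * x * (+ 1 + x) - + 3 * (+ 1 + x)

  prepend-alternatingTrueForm : ∀ Y K →
    prepend x false (prepend x true (alternatingTrueForm Y K)) ≡ alternatingTrueForm ((+ 1 + x) * Y) (+ 1 + K)
  prepend-alternatingTrueForm Y K = cong₂ _,_ (e₁ x Y) (cong₂ _,_ (e₂ x Y) (e₃ x Y K))
    where
    e₁ : ∀ x Y → Y + x * Y ≡ (+ 1 + x) * Y
    e₁ = solve-∀
    e₂ : ∀ x Y → (+ 2 * Y - + 1 + x * Y) + x * Y ≡ + 2 * ((+ 1 + x) * Y) - + 1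
    e₂ = solve-∀
    e₃ : ∀ x Y K →
      ((x + + 4) * Y - (+ 2 * K + + 1) * x - + 3 + x * (+ 2 * Y - + 1)) + x * (+ 2 * Y - + 1 + x * Y)
        ≡ (x + + 4) * ((+ 1 + x) * Y) - (+ 2 * (+ 1 + K) + + 1) * x - + 3
    e₃ = solve-∀

  prepend-alternatingFalseForm : ∀ Y K →
    prepend x true (prepend x false (alternatingFalseForm Y K)) ≡ alternatingFalseForm ((+ 1 + x) * Y) (+ 1 + K)
  prepend-alternatingFalseForm Y K = cong₂ _,_ (e₁ x Y) (cong₂ _,_ (e₂ x Y) (e₃ x Y K))
    where
    e₁ : ∀ x Y → Y + x * Y ≡ (+ 1 + x) * Y
    e₁ = solve-∀
    e₂ : ∀ x Y → ((+ 2 + x) * Y - + 1 - x + x * Y) + x * (Y + x * Y) ≡ (+ 2 + x) * ((+ 1 + x) * Y) - + 1 - x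
    e₂ = solve-∀
    e₃ : ∀ x Y K →
      ((+ 4 + + 3 * x) * Y - + 2 * K * x * (+ 1 + x) - + 3 * (+ 1 + x) + x * ((+ 2 + x) * Y - + 1 - x))
        + x * ((+ 2 + x) * Y - + 1 - x + x * Y)
        ≡ (+ 4 + + 3 * x) * ((+ 1 + x) * Y) - + 2 * (+ 1 + K) * x * (+ 1 + x) - + 3 * (+ 1 + x)
    e₃ = solve-∀

  profile-alternating-true : ∀ k → profile x (alternating true (2 *ℕ k)) ≡ alternatingTrueForm ((+ 1 + x) ^ k) (+ k)
  profile-alternating-true zero    = cong (λ p → + 1 , + 1 , p) (base x)
    where
    base : ∀ x → + 1 ≡ (x + + 4) * + 1 - (+ 2 * + 0 + + 1) * x - + 3
    base = solve-∀
  profile-alternating-true (suc k) = begin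
    profile x (alternating true (2 *ℕ suc k))
      ≡⟨ cong (profile x ∘ alternating true) (*ℕ-suc 2 k) ⟩
    profile x (alternating true (suc (suc (2 *ℕ k))))
      ≡⟨ cong (profile x) (alternating-suc-suc-double true k) ⟩
    prepend x false (prepend x true (profile x (alternating true (2 *ℕ k))))
      ≡⟨ cong (prepend x false ∘ prepend x true) (profile-alternating-true k) ⟩
    prepend x false (prepend x true (alternatingTrueForm ((+ 1 + x) ^ k) (+ k)))
      ≡⟨ prepend-alternatingTrueForm ((+ 1 + x) ^ k) (+ k) ⟩
    alternatingTrueForm ((+ 1 + x) ^ suc k) (+ suc k) ∎

  profile-alternating-false : ∀ k → profile x (alternating false (2 *ℕ k)) ≡ alternatingFalseForm ((+ 1 + x) ^ k) (+ k)
  profile-alternating-false zero    = cong₂ (λ p₂ p₃ → + 1 , p₂ , p₃) (base₂ x) (base₃ x)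
    where
    base₂ : ∀ x → + 1 ≡ (+ 2 + x) * + 1 - + 1 - x
    base₂ = solve-∀
    base₃ : ∀ x → + 1 ≡ (+ 4 + + 3 * x) * + 1 - + 2 * + 0 * x * (+ 1 + x) - + 3 * (+ 1 + x)
    base₃ = solve-∀
  profile-alternating-false (suc k) = begin
    profile x (alternating false (2 *ℕ suc k))
      ≡⟨ cong (profile x ∘ alternating false) (*ℕ-suc 2 k) ⟩
    profile x (alternating false (suc (suc (2 *ℕ k))))
      ≡⟨ cong (profile x) (alternating-suc-suc-double false k) ⟩
    prepend x true (prepend x false (profile x (alternating false (2 *ℕ k))))
      ≡⟨ cong (prepend x true ∘ prepend x false) (profile-alternating-false k) ⟩
    prepend x true (prepend x false (alternatingFalseForm ((+ 1 + x) ^ k) (+ k)))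
      ≡⟨ prepend-alternatingFalseForm ((+ 1 + x) ^ k) (+ k) ⟩
    alternatingFalseForm ((+ 1 + x) ^ suc k) (+ suc k) ∎

  I-A-alternating : ∀ M → I-A (suc (suc M)) x ≡ third (profile x (false ∷ false ∷ alternating true M))
  I-A-alternating M = trans (indepPoly≡profile (bitsA (suc (suc M))) x) (cong (third ∘ profile x) (bitsA-alternating M))

  I-Ā-alternating : ∀ M → I-Ā (suc (suc M)) x ≡ third (profile x (false ∷ false ∷ alternating false M))
  I-Ā-alternating M = trans (indepPoly≡profile (bitsĀ (suc (suc M))) x) (cong (third ∘ profile x) (bitsĀ-alternating M))

  I-A-even : ∀ m → I-A (2 *ℕ suc m) x
    ≡ (+ 1 + x) ^ suc (suc m) + + 3 * (+ 1 + x) ^ suc m - + (2 *ℕ suc m +ℕ 1) * x - + 3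
  I-A-even m = begin
    I-A (2 *ℕ suc m) x
      ≡⟨ cong (λ N → I-A N x) (*ℕ-suc 2 m) ⟩
    I-A (suc (suc (2 *ℕ m))) x
      ≡⟨ I-A-alternating (2 *ℕ m) ⟩
    third (profile x (false ∷ false ∷ alternating true (2 *ℕ m)))
      ≡⟨ cong (third ∘ prepend x false ∘ prepend x false) (profile-alternating-true m) ⟩
    third (prepend x false (prepend x false (alternatingTrueForm ((+ 1 + x) ^ m) (+ m))))
      ≡⟨ e x ((+ 1 + x) ^ m) (+ m) ⟩
    (+ 1 + x) ^ suc (suc m) + + 3 * (+ 1 + x) ^ suc m - + (2 *ℕ suc m +ℕ 1) * x - + 3 ∎
    where
    e : ∀ x Y K →
      ((x + + 4) * Y - (+ 2 * K + + 1) * x - + 3 + x * (+ 2 * Y - + 1)) + x * (+ 2 * Y - + 1 + x * Y)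
        ≡ (+ 1 + x) * ((+ 1 + x) * Y) + + 3 * ((+ 1 + x) * Y) - (+ 2 * (+ 1 + K) + + 1) * x - + 3
    e = solve-∀

  I-Ā-even : ∀ m → I-Ā (2 *ℕ suc m) x
    ≡ + 3 * (+ 1 + x) ^ suc (suc m) + (+ 1 + x) ^ suc m - (+ 1 + x) * (+ (2 *ℕ suc m) * x + + 3)
  I-Ā-even m = begin
    I-Ā (2 *ℕ suc m) x
      ≡⟨ cong (λ N → I-Ā N x) (*ℕ-suc 2 m) ⟩
    I-Ā (suc (suc (2 *ℕ m))) x
      ≡⟨ I-Ā-alternating (2 *ℕ m) ⟩
    third (profile x (false ∷ false ∷ alternating false (2 *ℕ m)))
      ≡⟨ cong (third ∘ prepend x false ∘ prepend x false) (profile-alternating-false m) ⟩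
    third (prepend x false (prepend x false (alternatingFalseForm ((+ 1 + x) ^ m) (+ m))))
      ≡⟨ e x ((+ 1 + x) ^ m) (+ m) ⟩
    + 3 * (+ 1 + x) ^ suc (suc m) + (+ 1 + x) ^ suc m - (+ 1 + x) * (+ (2 *ℕ suc m) * x + + 3) ∎
    where
    e : ∀ x Y K →
      ((+ 4 + + 3 * x) * Y - + 2 * K * x * (+ 1 + x) - + 3 * (+ 1 + x) + x * ((+ 2 + x) * Y - + 1 - x))
        + x * ((+ 2 + x) * Y - + 1 - x + x * Y)
        ≡ + 3 * ((+ 1 + x) * ((+ 1 + x) * Y)) + (+ 1 + x) * Y - (+ 1 + x) * (+ 2 * (+ 1 + K) * x + + 3)
    e = solve-∀

  I-A-odd : ∀ m → I-A (2 *ℕ suc m ∸ 1) x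
    ≡ + 3 * (+ 1 + x) ^ suc m + (+ 1 + x) ^ (suc m ∸ 1) - + (2 *ℕ suc m) * x - + 3
  I-A-odd zero = trans (indepPoly≡profile (bitsA 1) x) (e x)
    where
    e : ∀ x → + 1 + x * + 1 ≡ + 3 * ((+ 1 + x) * + 1) + + 1 - + 2 * x - + 3
    e = solve-∀
  I-A-odd (suc k) = begin
    I-A (2 *ℕ suc (suc k) ∸ 1) x
      ≡⟨ cong (λ N → I-A N x) (double-suc-suc∸1 k) ⟩
    I-A (suc (suc (suc (2 *ℕ k)))) x
      ≡⟨ I-A-alternating (suc (2 *ℕ k)) ⟩
    third (profile x (false ∷ false ∷ alternating true (suc (2 *ℕ k))))
      ≡⟨ cong (third ∘ profile x ∘ (λ v → false ∷ false ∷ v)) (alternating-suc-double true k) ⟩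
    third (profile x (false ∷ false ∷ true ∷ alternating true (2 *ℕ k)))
      ≡⟨ cong (third ∘ prepend x false ∘ prepend x false ∘ prepend x true) (profile-alternating-true k) ⟩
    third (prepend x false (prepend x false (prepend x true (alternatingTrueForm ((+ 1 + x) ^ k) (+ k)))))
      ≡⟨ e x ((+ 1 + x) ^ k) (+ k) ⟩
    + 3 * (+ 1 + x) ^ suc (suc k) + (+ 1 + x) ^ suc k - + (2 *ℕ suc (suc k)) * x - + 3 ∎
    where
    e : ∀ x Y K →
      (((x + + 4) * Y - (+ 2 * K + + 1) * x - + 3 + x * (+ 2 * Y - + 1)) + x * (+ 2 * Y - + 1 + x * Y))
        + x * ((+ 2 * Y - + 1 + x * Y) + x * Y)
        ≡ + 3 * ((+ 1 + x) * ((+ 1 + x) * Y)) + (+ 1 + x) * Y - + 2 * (+ 1 + (+ 1 + K)) * x - + 3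
    e = solve-∀

  I-Ā-odd : ∀ m → I-Ā (2 *ℕ suc m ∸ 1) x
    ≡ (+ 1 + x) ^ suc (suc m) + + 3 * (+ 1 + x) ^ suc m - (+ 1 + x) * (+ (2 *ℕ suc m ∸ 1) * x + + 3)
  I-Ā-odd zero = trans (indepPoly≡profile (bitsĀ 1) x) (e x)
    where
    e : ∀ x → + 1 + x * + 1 ≡ (+ 1 + x) * ((+ 1 + x) * + 1) + + 3 * ((+ 1 + x) * + 1) - (+ 1 + x) * (+ 1 * x + + 3)
    e = solve-∀
  I-Ā-odd (suc k) = begin
    I-Ā (2 *ℕ suc (suc k) ∸ 1) x
      ≡⟨ cong (λ N → I-Ā N x) (double-suc-suc∸1 k) ⟩
    I-Ā (suc (suc (suc (2 *ℕ k)))) x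
      ≡⟨ I-Ā-alternating (suc (2 *ℕ k)) ⟩
    third (profile x (false ∷ false ∷ alternating false (suc (2 *ℕ k))))
      ≡⟨ cong (third ∘ profile x ∘ (λ v → false ∷ false ∷ v)) (alternating-suc-double false k) ⟩
    third (profile x (false ∷ false ∷ false ∷ alternating false (2 *ℕ k)))
      ≡⟨ cong (third ∘ prepend x false ∘ prepend x false ∘ prepend x false) (profile-alternating-false k) ⟩
    third (prepend x false (prepend x false (prepend x false (alternatingFalseForm ((+ 1 + x) ^ k) (+ k)))))
      ≡⟨ e x ((+ 1 + x) ^ k) (+ k) ⟩
    (+ 1 + x) ^ suc (suc (suc k)) + + 3 * (+ 1 + x) ^ suc (suc k)
      - (+ 1 + x) * (+ (2 *ℕ suc (suc k) ∸ 1) * x + + 3) ∎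
    where
    e : ∀ x Y K →
      (((+ 4 + + 3 * x) * Y - + 2 * K * x * (+ 1 + x) - + 3 * (+ 1 + x) + x * ((+ 2 + x) * Y - + 1 - x))
        + x * ((+ 2 + x) * Y - + 1 - x + x * Y))
        + x * (((+ 2 + x) * Y - + 1 - x + x * Y) + x * (Y + x * Y))
        ≡ (+ 1 + x) * ((+ 1 + x) * ((+ 1 + x) * Y)) + + 3 * ((+ 1 + x) * ((+ 1 + x) * Y))
          - (+ 1 + x) * ((+ 2 * (+ 1 + (+ 1 + K)) - + 1) * x + + 3)
    e = solve-∀

theorem2p3 : ∀ (n : ℕ) → n ≥ 1 → ∀ (x : ℤ) →
    (I-A (2 Data.Nat.* n ∸ 1) x
      ≡ + 3 * (+ 1 + x) ^ n + (+ 1 + x) ^ (n ∸ 1) - + (2 Data.Nat.* n) * x - + 3)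
  × (I-Ā (2 Data.Nat.* n) x
      ≡ + 3 * (+ 1 + x) ^ (Data.Nat.suc n) + (+ 1 + x) ^ n
        - (+ 1 + x) * (+ (2 Data.Nat.* n) * x + + 3))
  × (I-Ā (2 Data.Nat.* n ∸ 1) x
      ≡ (+ 1 + x) ^ (Data.Nat.suc n) + + 3 * (+ 1 + x) ^ n
        - (+ 1 + x) * (+ (2 Data.Nat.* n ∸ 1) * x + + 3))
  × (I-A (2 Data.Nat.* n) x
      ≡ (+ 1 + x) ^ (Data.Nat.suc n) + + 3 * (+ 1 + x) ^ n
        - + (2 Data.Nat.* n Data.Nat.+ 1) * x - + 3)
theorem2p3 (suc m) _ x = I-A-odd x m , I-Ā-even x m , I-Ā-odd x m , I-A-even x m
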